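{- If $M$ is a weakly round matroid and $X, Y \subseteq E(M)$ satisfy $r_M(X) < r_M(Y)$, then $M$ has a minor $N$ such that $N|X = M|X$, $N|Y = M|Y$, and $Y$ is spanning in $N$.
   Context: A rank-$r$ matroid is weakly round if every cocircuit has rank at least $r-1$. -}

module Defs where

open import Data.Nat using (ℕ; _+_; _∸_; _≤_)
open import Data.Fin.Subset using (Subset; _⊆_; _⊂_; _∪_; _∩_; ∁; ⊤; ∣_∣; Empty; Nonempty)
open import Data.Product using (Σ; _×_)
open import Relation.Binary.PropositionalEquality using (_≡_)

record Matroid (n : ℕ) : Set where
  field
    r        : Subset n → ℕ
    r-bound  : ∀ X → r X ≤ ∣ X ∣
    r-mono   : ∀ {X Y} → X ⊆ Y → r X ≤ r Y
    r-submod : ∀ X Y → r (X ∪ Y) + r (X ∩ Y) ≤ r X + r Y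
open Matroid public

module _ {n : ℕ} (M : Matroid n) where

  rank : ℕ
  rank = r M ⊤

  Independent : Subset n → Set
  Independent B = r M B ≡ ∣ B ∣

  IsBasis : Subset n → Set
  IsBasis B = Independent B × (r M B ≡ rank)

  MeetsEveryBasis : Subset n → Set
  MeetsEveryBasis C = ∀ B → IsBasis B → Nonempty (C ∩ B)

  IsCocircuit : Subset n → Set
  IsCocircuit C = MeetsEveryBasis C × (∀ D → D ⊂ C → Σ (Subset n) λ B → IsBasis B × Empty (D ∩ B))

  WeaklyRound : Set
  WeaklyRound = ∀ C → IsCocircuit C → rank ∸ 1 ≤ r M C

  record Minor : Set where
    field
      con      : Subset n
      del      : Subset n
      disjoint : Empty (con ∩ del)

  module _ (N : Minor) where
    open Minor N

    ground : Subset n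
    ground = ∁ (con ∪ del)

    rN : Subset n → ℕ
    rN Z = r M (Z ∪ con) ∸ r M con

    SameRestriction : Subset n → Set
    SameRestriction X = X ⊆ ground × (∀ Z → Z ⊆ X → rN Z ≡ r M Z)

    SpanningIn : Subset n → Set
    SpanningIn Y = Y ⊆ ground × (rN Y ≡ rN ground)

module Submission where

-- We take N = M / K for a set K that is *skew* to both X and Y,
-- i.e. disjoint from them with r(W ∪ K) = r(W) + r(K) for W ∈ {X, Y};
-- skewness of K to W is exactly what makes (M / K)|W = M|W.  Starting
-- from K = ∅ we enlarge K one element at a time until Y ∪ K spans M, at
-- which point Y spans M / K.  While Y ∪ K does not span, the elements
-- outside cl(Y ∪ K) meet every basis, so they contain a cocircuit C.  As
-- r(X ∪ K) < r(Y ∪ K) < r(M), weak roundness gives r(C) ≥ r(M) - 1 >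
-- r(X ∪ K), so some e ∈ C lies outside cl(X ∪ K) as well; adding such an
-- e to K raises both r(X ∪ K) and r(Y ∪ K) by one and keeps K skew to X
-- and Y.  Each step raises r(Y ∪ K), so the process stops.

open import Defs
open import Level using (Level)
open import Data.Nat using (ℕ; zero; suc; _+_; _∸_; _≤_; _<_; s≤s; _≤?_)
open import Data.Nat.Properties
open import Data.Fin using (Fin)
open import Data.Fin.Properties using (any?) renaming (_≟_ to _≟ᶠ_)
open import Data.Fin.Subset
open import Data.Fin.Subset.Properties
open import Data.Fin.Subset.Induction using (Acc; acc; ⊂-wellFounded)
open import Data.Product using (Σ; _×_; _,_; proj₂)
open import Data.Sum using (inj₁; inj₂; [_,_])
open import Data.Vec using (tabulate)
open import Data.Vec.Properties using (lookup∘tabulate; []=⇒lookup; lookup⇒[]=)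
open import Data.Empty using (⊥-elim)
open import Relation.Unary using (Pred; Decidable)
open import Relation.Nullary using (Dec; yes; no; ¬_)
open import Relation.Nullary.Decidable using (_×-dec_; ¬?)
open import Relation.Binary.PropositionalEquality
  using (_≡_; refl; sym; trans; cong; cong₂; subst; subst₂)

module Selection {n : ℕ} {ℓ : Level} {P : Pred (Fin n) ℓ} (P? : Decidable P) where

  private
    side : ∀ {A : Set ℓ} → Dec A → Side
    side (yes _) = inside
    side (no _)  = outside

    side-inside : ∀ {A : Set ℓ} (d : Dec A) → side d ≡ inside → A
    side-inside (yes a) _ = a
    side-inside (no _) ()

    side-yes : ∀ {A : Set ℓ} → A → (d : Dec A) → side d ≡ inside
    side-yes _ (yes _)  = refl
    side-yes a (no ¬a) = ⊥-elim (¬a a)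

  select : Subset n
  select = tabulate (λ e → side (P? e))

  select-sound : ∀ {e} → e ∈ select → P e
  select-sound {e} e∈ =
    side-inside (P? e) (trans (sym (lookup∘tabulate _ e)) ([]=⇒lookup e∈))

  select-complete : ∀ {e} → P e → e ∈ select
  select-complete {e} pe =
    lookup⇒[]= e select (trans (lookup∘tabulate _ e) (side-yes pe (P? e)))

open Selection using (select; select-sound; select-complete)

∪-lub : ∀ {n} {A B C : Subset n} → A ⊆ C → B ⊆ C → A ∪ B ⊆ C
∪-lub {A = A} {B} A⊆C B⊆C x∈ = [ A⊆C , B⊆C ] (x∈p∪q⁻ A B x∈)

module RankFacts {n : ℕ} (M : Matroid n) where

  rk : Subset n → ℕ
  rk = r M

  rk-⊥ : rk ⊥ ≡ 0
  rk-⊥ = n≤0⇒n≡0 (subst (rk ⊥ ≤_) (∣⊥∣≡0 n) (r-bound M ⊥))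

  rk-subadditive : ∀ A B → rk (A ∪ B) ≤ rk A + rk B
  rk-subadditive A B = ≤-trans (m≤m+n _ _) (r-submod M A B)

  rk-adjoin : ∀ A e → rk (A ∪ ⁅ e ⁆) ≤ suc (rk A)
  rk-adjoin A e = begin
    rk (A ∪ ⁅ e ⁆)   ≤⟨ rk-subadditive A ⁅ e ⁆ ⟩
    rk A + rk ⁅ e ⁆  ≤⟨ +-monoʳ-≤ (rk A) (subst (rk ⁅ e ⁆ ≤_) (∣⁅x⁆∣≡1 e) (r-bound M ⁅ e ⁆)) ⟩
    rk A + 1         ≡⟨ +-comm (rk A) 1 ⟩
    suc (rk A)       ∎
    where open ≤-Reasoning

  infix 4 _∈cl_ _∈cl?_

  _∈cl_ : Fin n → Subset n → Set
  e ∈cl A = rk (A ∪ ⁅ e ⁆) ≡ rk A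

  _∈cl?_ : ∀ e A → Dec (e ∈cl A)
  e ∈cl? A = rk (A ∪ ⁅ e ⁆) ≟ rk A

  ∈⇒∈cl : ∀ {A e} → e ∈ A → e ∈cl A
  ∈⇒∈cl {A} {e} e∈A = ≤-antisym
    (r-mono M (∪-lub (λ x∈ → x∈) (λ x∈ → subst (_∈ A) (sym (x∈⁅y⁆⇒x≡y e x∈)) e∈A)))
    (r-mono M (p⊆p∪q ⁅ e ⁆))

  ∉cl⇒rank-suc : ∀ {A e} → ¬ e ∈cl A → rk (A ∪ ⁅ e ⁆) ≡ suc (rk A)
  ∉cl⇒rank-suc {A} {e} e∉cl =
    ≤-antisym (rk-adjoin A e) (≤∧≢⇒< (r-mono M (p⊆p∪q ⁅ e ⁆)) (λ eq → e∉cl (sym eq)))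

  cl-union : ∀ A B C → rk (A ∪ B) ≡ rk A → rk (A ∪ C) ≡ rk A → rk (A ∪ (B ∪ C)) ≡ rk A
  cl-union A B C AB AC = ≤-antisym (+-cancelʳ-≤ (rk A) _ _ bound) (r-mono M (p⊆p∪q (B ∪ C)))
    where
    open ≤-Reasoning
    ABC⊆ : A ∪ (B ∪ C) ⊆ (A ∪ B) ∪ (A ∪ C)
    ABC⊆ x∈ with x∈p∪q⁻ A (B ∪ C) x∈
    ... | inj₁ x∈A = p⊆p∪q (A ∪ C) (p⊆p∪q B x∈A)
    ... | inj₂ x∈BC = [ (λ x∈B → p⊆p∪q (A ∪ C) (q⊆p∪q A B x∈B))
                      , (λ x∈C → q⊆p∪q (A ∪ B) (A ∪ C) (q⊆p∪q A C x∈C)) ] (x∈p∪q⁻ B C x∈BC)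
    bound : rk (A ∪ (B ∪ C)) + rk A ≤ rk A + rk A
    bound = begin
      rk (A ∪ (B ∪ C)) + rk A
        ≤⟨ +-mono-≤ (r-mono M ABC⊆)
                    (r-mono M (λ x∈ → x∈p∩q⁺ (p⊆p∪q B x∈ , p⊆p∪q C x∈))) ⟩
      rk ((A ∪ B) ∪ (A ∪ C)) + rk ((A ∪ B) ∩ (A ∪ C))
        ≤⟨ r-submod M (A ∪ B) (A ∪ C) ⟩
      rk (A ∪ B) + rk (A ∪ C)
        ≡⟨ cong₂ _+_ AB AC ⟩
      rk A + rk A ∎

  cl-absorbs : ∀ A T → Acc _⊂_ T → (∀ {e} → e ∈ T → e ∈cl A) → rk (A ∪ T) ≡ rk A
  cl-absorbs A T (acc smaller) T⊆cl with nonempty? T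
  ... | no T-empty =
    ≤-antisym (r-mono M (∪-lub (λ x∈ → x∈) (λ x∈ → ⊥-elim (T-empty (_ , x∈)))))
              (r-mono M (p⊆p∪q T))
  ... | yes (x , x∈T) = ≤-antisym (≤-trans (r-mono M T-split) (≤-reflexive rest+x))
                                  (r-mono M (p⊆p∪q T))
    where
    rest+x : rk (A ∪ ((T - x) ∪ ⁅ x ⁆)) ≡ rk A
    rest+x = cl-union A (T - x) ⁅ x ⁆
      (cl-absorbs A (T - x) (smaller (x∈p⇒p-x⊂p x∈T)) (λ y∈ → T⊆cl (p─q⊆p T ⁅ x ⁆ y∈)))
      (T⊆cl x∈T)
    T-split : A ∪ T ⊆ A ∪ ((T - x) ∪ ⁅ x ⁆)
    T-split {y} y∈ with x∈p∪q⁻ A T y∈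
    ... | inj₁ y∈A = p⊆p∪q _ y∈A
    ... | inj₂ y∈T with y ≟ᶠ x
    ...   | yes refl = q⊆p∪q A _ (q⊆p∪q (T - x) ⁅ x ⁆ (x∈⁅x⁆ x))
    ...   | no y≢x  = q⊆p∪q A _ (p⊆p∪q ⁅ x ⁆ (x∈p∧x≢y⇒x∈p-y y∈T y≢x))

  escape : ∀ A T → rk A < rk T → Σ (Fin n) λ e → e ∈ T × ¬ e ∈cl A
  escape A T A<T with any? (λ e → (e ∈? T) ×-dec ¬? (e ∈cl? A))
  ... | yes found = found
  ... | no none = ⊥-elim (<⇒≱ A<T (begin
      rk T        ≤⟨ r-mono M (q⊆p∪q A T) ⟩
      rk (A ∪ T)  ≡⟨ cl-absorbs A T (⊂-wellFounded T) T⊆cl ⟩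
      rk A        ∎))
    where
    open ≤-Reasoning
    T⊆cl : ∀ {e} → e ∈ T → e ∈cl A
    T⊆cl {e} e∈T with e ∈cl? A
    ... | yes e∈cl = e∈cl
    ... | no e∉cl = ⊥-elim (none (e , e∈T , e∉cl))

module Cocircuits {n : ℕ} (M : Matroid n) where
  open RankFacts M

  AvoidingBasis : Subset n → Set
  AvoidingBasis C = Σ (Subset n) λ B → IsBasis M B × Empty (C ∩ B)

  avoidingBasis? : ∀ C → Dec (AvoidingBasis C)
  avoidingBasis? C = anySubset? λ B →
    ((rk B ≟ ∣ B ∣) ×-dec (rk B ≟ rank M)) ×-dec ¬? (nonempty? (C ∩ B))

  no-avoiding⇒meets : ∀ {C} → ¬ AvoidingBasis C → MeetsEveryBasis M C
  no-avoiding⇒meets {C} ¬avoid B isB with nonempty? (C ∩ B)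
  ... | yes meets = meets
  ... | no misses = ⊥-elim (¬avoid (B , isB , misses))

  meetsEveryBasis? : ∀ C → Dec (MeetsEveryBasis M C)
  meetsEveryBasis? C with avoidingBasis? C
  ... | yes (B , isB , misses) = no (λ meets → misses (meets B isB))
  ... | no ¬avoid = yes (no-avoiding⇒meets ¬avoid)

  ¬meets⇒avoiding : ∀ {C} → ¬ MeetsEveryBasis M C → AvoidingBasis C
  ¬meets⇒avoiding {C} ¬meets with avoidingBasis? C
  ... | yes avoid = avoid
  ... | no ¬avoid = ⊥-elim (¬meets (no-avoiding⇒meets ¬avoid))

  cocircuit-within : ∀ C → Acc _⊂_ C → MeetsEveryBasis M C
                   → Σ (Subset n) λ D → D ⊆ C × IsCocircuit M D
  cocircuit-within C (acc smaller) meets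
    with any? (λ x → (x ∈? C) ×-dec meetsEveryBasis? (C - x))
  ... | yes (x , x∈C , meets-x) =
    let (D , D⊆ , cocircuit) = cocircuit-within (C - x) (smaller (x∈p⇒p-x⊂p x∈C)) meets-x
    in D , (λ y∈ → p─q⊆p C ⁅ x ⁆ (D⊆ y∈)) , cocircuit
  ... | no irreducible = C , (λ y∈ → y∈) , meets , minimal
    where
    minimal : ∀ D → D ⊂ C → AvoidingBasis D
    minimal D (D⊆C , x , x∈C , x∉D) with meetsEveryBasis? (C - x)
    ... | yes meets-x = ⊥-elim (irreducible (x , x∈C , meets-x))
    ... | no ¬meets-x =
      let (B , isB , misses) = ¬meets⇒avoiding ¬meets-x
          D⊆C-x : ∀ {y} → y ∈ D → y ∈ C - x
          D⊆C-x {y} y∈D = x∈p∧x≢y⇒x∈p-y (D⊆C y∈D) (λ { refl → x∉D y∈D })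
      in B , isB , λ { (y , y∈) →
           let (y∈D , y∈B) = x∈p∩q⁻ D B y∈ in misses (y , x∈p∩q⁺ (D⊆C-x y∈D , y∈B)) }

  coclosure : Subset n → Subset n
  coclosure S = select (λ e → ¬? (e ∈cl? S))

  coclosure-meets-bases : ∀ S → rk S < rank M → MeetsEveryBasis M (coclosure S)
  coclosure-meets-bases S S<r B (_ , rB) =
    let (e , e∈B , e∉cl) = escape S B (subst (rk S <_) (sym rB) S<r)
    in e , x∈p∩q⁺ (select-complete _ e∉cl , e∈B)

module WeaklyRoundMatroids {n : ℕ} (M : Matroid n) (weaklyRound : WeaklyRound M) where
  open RankFacts M
  open Cocircuits M

  outside-two-closures : ∀ S A → rk S < rank M → suc (rk A) < rank M
                       → Σ (Fin n) λ e → ¬ e ∈cl S × ¬ e ∈cl A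
  outside-two-closures S A S<r A+1<r =
    let (C , C⊆ , cocircuit) = cocircuit-within (coclosure S) (⊂-wellFounded _)
                                 (coclosure-meets-bases S S<r)
        A<C : rk A < rk C
        A<C = ≤-trans (∸-monoˡ-≤ 1 A+1<r) (weaklyRound C cocircuit)
        (e , e∈C , e∉clA) = escape A C A<C
    in e , select-sound _ (C⊆ e∈C) , e∉clA

module Skewness {n : ℕ} (M : Matroid n) where
  open RankFacts M

  record Skew (W K : Subset n) : Set where
    field
      disjoint : ∀ {x} → x ∈ W → x ∉ K
      additive : rk (W ∪ K) ≡ rk W + rk K
  open Skew

  skew-⊥ : ∀ W → Skew W ⊥
  skew-⊥ W = record
    { disjoint = λ _ → ∉⊥
    ; additive = trans (cong rk (∪-identityʳ W))
                       (sym (trans (cong (rk W +_) rk-⊥) (+-identityʳ (rk W))))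
    }

  rank-adjoin-outside : ∀ W K {e} → ¬ e ∈cl (W ∪ K)
                      → rk (W ∪ (K ∪ ⁅ e ⁆)) ≡ suc (rk (W ∪ K))
  rank-adjoin-outside W K {e} e∉cl =
    trans (cong rk (sym (∪-assoc W K ⁅ e ⁆))) (∉cl⇒rank-suc e∉cl)

  skew-extend : ∀ {W K e} → Skew W K → ¬ e ∈cl (W ∪ K) → Skew W (K ∪ ⁅ e ⁆)
  skew-extend {W} {K} {e} skew e∉cl = record
    { disjoint = disjoint′
    ; additive = ≤-antisym (rk-subadditive W K′) (+-cancelˡ-≤ (suc (rk K)) _ _ lower)
    }
    where
    K′ = K ∪ ⁅ e ⁆
    open ≤-Reasoning
    disjoint′ : ∀ {x} → x ∈ W → x ∉ K′
    disjoint′ x∈W x∈K′ with x∈p∪q⁻ K ⁅ e ⁆ x∈K′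
    ... | inj₁ x∈K = disjoint skew x∈W x∈K
    ... | inj₂ x∈e with x∈⁅y⁆⇒x≡y e x∈e
    ...   | refl = e∉cl (∈⇒∈cl (p⊆p∪q K x∈W))
    lower : suc (rk K) + (rk W + rk K′) ≤ suc (rk K) + rk (W ∪ K′)
    lower = begin
      suc (rk K) + (rk W + rk K′)  ≤⟨ +-monoʳ-≤ (suc (rk K)) (+-monoʳ-≤ (rk W) (rk-adjoin K e)) ⟩
      suc (rk K) + (rk W + suc (rk K))
        ≡⟨ cong (suc (rk K) +_) (trans (+-suc (rk W) (rk K)) (sym (cong suc (additive skew)))) ⟩
      suc (rk K) + suc (rk (W ∪ K))  ≡⟨ cong (suc (rk K) +_) (sym (rank-adjoin-outside W K e∉cl)) ⟩
      suc (rk K) + rk (W ∪ K′) ∎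

  skew-⊆ : ∀ {W K Z} → Skew W K → Z ⊆ W → rk (Z ∪ K) ≡ rk Z + rk K
  skew-⊆ {W} {K} {Z} skew Z⊆W =
    ≤-antisym (rk-subadditive Z K) (+-cancelˡ-≤ (rk W) _ _ lower)
    where
    open ≤-Reasoning
    lower : rk W + (rk Z + rk K) ≤ rk W + rk (Z ∪ K)
    lower = begin
      rk W + (rk Z + rk K)  ≡⟨ cong (rk W +_) (+-comm (rk Z) (rk K)) ⟩
      rk W + (rk K + rk Z)  ≡⟨ sym (+-assoc (rk W) (rk K) (rk Z)) ⟩
      rk W + rk K + rk Z    ≡⟨ cong (_+ rk Z) (sym (additive skew)) ⟩
      rk (W ∪ K) + rk Z
        ≤⟨ +-mono-≤ (r-mono M (∪-lub (λ x∈ → q⊆p∪q (Z ∪ K) W x∈) (λ x∈ → p⊆p∪q W (q⊆p∪q Z K x∈))))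
                    (r-mono M (λ x∈ → x∈p∩q⁺ (p⊆p∪q K x∈ , Z⊆W x∈))) ⟩
      rk ((Z ∪ K) ∪ W) + rk ((Z ∪ K) ∩ W)  ≤⟨ r-submod M (Z ∪ K) W ⟩
      rk (Z ∪ K) + rk W     ≡⟨ +-comm (rk (Z ∪ K)) (rk W) ⟩
      rk W + rk (Z ∪ K) ∎

  contraction : Subset n → Minor M
  contraction K = record
    { con = K ; del = ⊥ ; disjoint = λ (y , y∈) → ∉⊥ (proj₂ (x∈p∩q⁻ K ⊥ y∈)) }

  disjoint⇒⊆ground : ∀ {K W} → (∀ {x} → x ∈ W → x ∉ K) → W ⊆ ground M (contraction K)
  disjoint⇒⊆ground {K} W∩K=∅ x∈W = x∉p⇒x∈∁p λ x∈K∪⊥ → [ W∩K=∅ x∈W , ∉⊥ ] (x∈p∪q⁻ K ⊥ x∈K∪⊥)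

  skew⇒same-restriction : ∀ {W K} → Skew W K → SameRestriction M (contraction K) W
  skew⇒same-restriction {W} {K} skew = disjoint⇒⊆ground (disjoint skew) , λ Z Z⊆W →
    trans (cong (_∸ rk K) (skew-⊆ skew Z⊆W)) (m+n∸n≡m (rk Z) (rk K))

  spanning-after-contraction : ∀ {Y K} → Skew Y K → rank M ≤ rk (Y ∪ K)
                             → SpanningIn M (contraction K) Y
  spanning-after-contraction {Y} {K} skew spans =
    Y⊆ground , cong (_∸ rk K) (≤-antisym (r-mono M (∪-lub (λ x∈ → p⊆p∪q K (Y⊆ground x∈)) (q⊆p∪q _ K)))
                                          (≤-trans (r-mono M ⊆⊤) spans))
    where
    Y⊆ground = disjoint⇒⊆ground (disjoint skew)

module Construction {n : ℕ} (M : Matroid n) (weaklyRound : WeaklyRound M)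
                    (X Y : Subset n) (X<Y : r M X < r M Y) where
  open RankFacts M
  open WeaklyRoundMatroids M weaklyRound
  open Skewness M
  open Skew

  Goal : Set
  Goal = Σ (Minor M) λ N → SameRestriction M N X × SameRestriction M N Y × SpanningIn M N Y

  -- One step of the construction: an element outside both cl(X ∪ K) and
  -- cl(Y ∪ K), which exists while Y ∪ K is not spanning because
  -- r(X ∪ K) = r(X) + r(K) < r(Y) + r(K) = r(Y ∪ K) < r(M).
  next-element : ∀ K → Skew X K → Skew Y K → rk (Y ∪ K) < rank M
               → Σ (Fin n) λ e → ¬ e ∈cl (Y ∪ K) × ¬ e ∈cl (X ∪ K)
  next-element K skewX skewY YK<r =
    outside-two-closures (Y ∪ K) (X ∪ K) YK<r (≤-trans (s≤s XK<YK) YK<r)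
    where
    XK<YK : rk (X ∪ K) < rk (Y ∪ K)
    XK<YK = subst₂ _<_ (sym (additive skewX)) (sym (additive skewY)) (+-monoˡ-< (rk K) X<Y)

  -- The fuel m bounds the number of elements still to be added.
  grow : ∀ m K → Skew X K → Skew Y K → rank M ≤ rk (Y ∪ K) + m → Goal
  grow m K skewX skewY fuel with rank M ≤? rk (Y ∪ K)
  ... | yes spans = contraction K , skew⇒same-restriction skewX , skew⇒same-restriction skewY
                  , spanning-after-contraction skewY spans
  grow zero K skewX skewY fuel | no ¬spans =
    ⊥-elim (¬spans (subst (rank M ≤_) (+-identityʳ _) fuel))
  grow (suc m) K skewX skewY fuel | no ¬spans
    with next-element K skewX skewY (≰⇒> ¬spans)
  ... | e , e∉clY , e∉clX =
    grow m (K ∪ ⁅ e ⁆) (skew-extend skewX e∉clX) (skew-extend skewY e∉clY) fuel′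
    where
    fuel′ : rank M ≤ rk (Y ∪ (K ∪ ⁅ e ⁆)) + m
    fuel′ = subst (rank M ≤_)
      (trans (+-suc (rk (Y ∪ K)) m) (cong (_+ m) (sym (rank-adjoin-outside Y K e∉clY)))) fuel

lemma4p3 : {n : ℕ} (M : Matroid n) → WeaklyRound M → (X Y : Subset n) → r M X < r M Y
    → Σ (Minor M) λ N → SameRestriction M N X × SameRestriction M N Y × SpanningIn M N Y
lemma4p3 M weaklyRound X Y X<Y =
  grow (rank M) ⊥ (skew-⊥ X) (skew-⊥ Y) (m≤n+m (rank M) (r M (Y ∪ ⊥)))
  where
  open Construction M weaklyRound X Y X<Y
  open Skewness M
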